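{- Algorithm Build-Sketches$(G,\ell)$ (described in the context) returns $X_v=\widetilde{N_\ell(v)}$ for all $v\in V$.
   Context: $G=(V,E)$ is an undirected unweighted graph and $\ell\ge1$ an integer; $N_d(v)$ is the set of vertices at distance at most $d$ from $v$, $N(v)=N_1(v)$, and $N(A)=\bigcup_{u\in A}N(u)$. Each vertex $v$ has an independent random rank $r_v\sim U(0,1)$ (assumed distinct). For $S\subseteq V$ and an integer $k\ge1$, $\widetilde S$ is the set of the $k$ elements of $S$ with smallest ranks ($\widetilde S=S$ if $|S|<k$). Merge-and-Purify$(X,\{v\})$ returns the $k$ smallest-rank elements of $X\cup\{v\}$. Build-Sketches$(G,\ell)$: initialize $X_v=\{v\}$ for all $v\in V$. Repeat at most $\ell$ times: for every $v\in V$ in increasing order of $r_v$, let $A_v$ be the set of vertices $u$ such that $v$ was added to $X_u$ in the previous iteration (for the first iteration, $A_v=\{v\}$ from the initialization), and for every $w\in N(A_v)$ set $X_w\leftarrow$ Merge-and-Purify$(X_w,\{v\})$; if no $X_v$ was modified during the iteration, stop. Return $\{X_v\}_{v\in V}$. -}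

module Defs where

open import Data.Nat using (ℕ; zero; suc; _≤_; _<_)
open import Data.Nat.Properties using (_<?_)
open import Data.Bool using (Bool; true; false; if_then_else_; _∨_; _∧_; not)
open import Data.Fin using (Fin; toℕ; _≟_)
open import Data.Fin.Permutation using (Permutation′; _⟨$⟩ʳ_; _⟨$⟩ˡ_)
open import Data.List using (List; []; _∷_; take; length; filterᵇ; foldl; map; allFin)
open import Data.Bool.ListAction using (any)
open import Data.List.Properties using (≡-dec)
open import Data.List.Membership.Propositional using (_∈_; _∉_)
open import Data.List.Relation.Unary.All using (All)
open import Data.List.Relation.Unary.Unique.Propositional using (Unique)
open import Data.Product using (_×_; _,_; proj₁; proj₂)
open import Data.Sum using (_⊎_)
open import Relation.Nullary using (does)
open import Relation.Binary.PropositionalEquality using (_≡_)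

record Graph (n : ℕ) : Set where
  field
    adj     : Fin n → Fin n → Bool
    symm    : ∀ u v → adj u v ≡ adj v u
    irrefl  : ∀ v → adj v v ≡ false
open Graph public

-- Within G d u w : dist(u , w) ≤ d  (there is a walk of length ≤ d).
data Within {n : ℕ} (G : Graph n) : ℕ → Fin n → Fin n → Set where
  here : ∀ {d u} → Within G d u u
  step : ∀ {d u x w} → Within G d u x → adj G x w ≡ true → Within G (suc d) u w

N[_]_ : ∀ {n} → (G : Graph n) → ℕ → Fin n → Fin n → Set
(N[ G ] d) v w = Within G d v w

-- Ranks.  Distinct ranks are modelled by a permutation π : the rank of v
-- is its position π(v) in the increasing order of ranks.

rank : ∀ {n} → Permutation′ n → Fin n → ℕ
rank π v = toℕ (π ⟨$⟩ʳ v)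

-- vertices in increasing order of rank
byRank : ∀ {n} → Permutation′ n → List (Fin n)
byRank {n} π = map (π ⟨$⟩ˡ_) (allFin n)

-- S̃ for a set S given as a predicate: X is the set of the k elements of S
-- with smallest ranks (all of S if |S| < k).

IsBottom : ∀ {n} → Permutation′ n → ℕ → (Fin n → Set) → List (Fin n) → Set
IsBottom π k S X =
    Unique X
  × All S X
  × length X ≤ k
  × (length X ≡ k ⊎ (∀ y → S y → y ∈ X))
  × (∀ x y → x ∈ X → S y → y ∉ X → rank π x < rank π y)

-- The algorithm.  Sketches are kept as lists sorted by increasing rank.

module Algorithm {n : ℕ} (G : Graph n) (π : Permutation′ n) (k : ℕ) where

  insertR : Fin n → List (Fin n) → List (Fin n)
  insertR v [] = v ∷ []
  insertR v (x ∷ xs) with does (v ≟ x)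
  ... | true  = x ∷ xs
  ... | false with does (rank π v <? rank π x)
  ...   | true  = v ∷ x ∷ xs
  ...   | false = x ∷ insertR v xs

  mergePurify : List (Fin n) → Fin n → List (Fin n)
  mergePurify X v = take k (insertR v X)

  open import Data.List.Membership.DecPropositional (_≟_ {n}) using (_∈?_)

  _∈ᵇ_ : Fin n → List (Fin n) → Bool
  v ∈ᵇ X = does (v ∈? X)

  inN : List (Fin n) → Fin n → Bool
  inN A w = any (λ a → does (a ≟ w) ∨ adj G a w) A

  Sketches : Set
  Sketches = Fin n → List (Fin n)

  record State : Set where
    constructor st
    field
      X       : Sketches
      A       : Fin n → List (Fin n)
      changed : Bool
  open State public

  update : Sketches → Fin n → List (Fin n) → Sketches
  update X w L u = if does (u ≟ w) then L else X u

  addTo : (Fin n → List (Fin n)) → Fin n → Fin n → (Fin n → List (Fin n))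
  addTo A v w u = if does (u ≟ v) then w ∷ A u else A u

  -- processing vertex v (with the A_v of the previous iteration, Aold v):
  -- for every w ∈ N(A_v), X_w ← Merge-and-Purify(X_w , {v}); record in the
  -- new A-table that v was added to X_w, and whether X_w was modified.
  processTarget : Fin n → State → Fin n → State
  processTarget v (st X Anew ch) w =
    st (update X w new)
       (if added then addTo Anew v w else Anew)
       (ch ∨ not (does (≡-dec _≟_ (X w) new)))
    where
    new   = mergePurify (X w) v
    added = (v ∈ᵇ new) ∧ not (v ∈ᵇ X w)

  processVertex : (Fin n → List (Fin n)) → State → Fin n → State
  processVertex Aold s v = foldl (processTarget v) s (filterᵇ (inN (Aold v)) (allFin n))

  -- one iteration: vertices in increasing rank order, A-table of the
  -- previous iteration fixed, fresh A-table and flag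
  iteration : State → State
  iteration (st X Aold _) =
    foldl (processVertex Aold) (st X (λ _ → []) false) (byRank π)

  run : ℕ → State → Sketches
  run zero    s = X s
  run (suc m) s with iteration s
  ... | s′ = if changed s′ then run m s′ else X s′

  initial : State
  initial = st (λ v → v ∷ []) (λ v → v ∷ []) false

buildSketches : ∀ {n} → Graph n → Permutation′ n → (k ℓ : ℕ) → Fin n → List (Fin n)
buildSketches G π k ℓ = Algorithm.run G π k ℓ (Algorithm.initial G π k)

-- Write S̃ for the k lowest-ranked elements of S.  Merging v into S̃ and purifying gives
-- (S ∪ {v})̃, so every sketch is S̃ for the set S of vertices merged into it so far.
-- Induct on the rounds: after round d, X_w = Ñ_d(w), and A_v lies within distance d of v
-- and contains every u at distance exactly d from v with v ∈ Ñ_d(u).  In round d + 1,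
-- X_w receives the v with w ∈ N(A_v), all of them in N_{d+1}(w).  Conversely, if
-- v ∈ Ñ_{d+1}(w) lies outside N_d(w), then w has a neighbour u at distance d from v,
-- and v ∈ Ñ_d(u) since N_d(u) ⊆ N_{d+1}(w); so u ∈ A_v and v is merged into X_w.  The
-- merged set thus lies between N_d(w) and N_{d+1}(w) and contains Ñ_{d+1}(w), whence
-- X_w = Ñ_{d+1}(w); such a v is new in X_w, so w joins the next A_v.  A round that
-- changes nothing leaves every A_v empty, and the same argument with nothing merged
-- gives Ñ_d(w) = Ñ_{d+1}(w), so stopping early is harmless.
module Submission where

open import Defs
open import Level using (Level; 0ℓ)
open import Function using (_∘_; case_of_)
open import Data.Nat using (ℕ; zero; suc; _+_; _≤_; _<_; _<ᵇ_)
open import Data.Nat.Properties using (<⇒<ᵇ; <ᵇ⇒<; _≤?_; ≤-refl; n≤1+n; <-irrefl; <-asym; m⊓n≤m; m≤n⇒m⊓n≡m; ≰⇒≥; +-suc; +-identityʳ)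
import Data.Bool as Bool
open import Data.Bool using (true; false; T)
open import Data.Bool.Properties using (T-∨; T-≡; T?)
open import Data.Unit using (tt)
open import Data.Empty using (⊥-elim)
open import Data.Fin using (Fin; toℕ; _≟_)
open import Data.Fin.Properties using (any?)
open import Data.Fin.Permutation using (Permutation′; _⟨$⟩ʳ_; _⟨$⟩ˡ_; inverseʳ; inverseˡ)
open import Data.Product using (_×_; _,_; proj₁; proj₂; ∃-syntax; uncurry)
open import Data.Product.Properties using () renaming (≡-dec to ×-≡-dec)
open import Data.Sum using (_⊎_; inj₁; inj₂; [_,_]′)
import Data.Sum as Sum
open import Data.List using (List; []; _∷_; take; length; filter; filterᵇ; foldl; map; concatMap; allFin; reverse; reverseAcc)
open import Data.List.Properties using (foldl-++; foldl-map; foldl-cong; length-take; take-all; take-take; take-[]; filter-≐; filter-accept; filter-reject; filter-none; ≡-dec)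
open import Data.List.Membership.Propositional using (_∈_; _∉_; find)
open import Data.List.Membership.Propositional.Properties using (∈-allFin; ∈-map⁺; ∈-filter⁺; ∈-concatMap⁺)
open import Data.List.Relation.Binary.Sublist.Propositional.Properties using (Any-resp-⊆; take⁺)
open import Data.List.Relation.Unary.Any using (here; there)
import Data.List.Relation.Unary.Any as Any
open import Data.List.Relation.Unary.Any.Properties using (any⁺; any⁻; reverse⁺)
open import Data.List.Relation.Unary.All using (All; []; _∷_)
import Data.List.Relation.Unary.All as All
import Data.List.Relation.Unary.All.Properties as All
open import Data.List.Relation.Unary.AllPairs using (AllPairs; []; _∷_)
import Data.List.Relation.Unary.AllPairs as AllPairs
import Data.List.Relation.Unary.AllPairs.Properties as AllPairs
open import Relation.Binary using (Rel)
open import Relation.Binary.PropositionalEquality using (_≡_; _≢_; refl; sym; trans; cong; subst; subst₂; module ≡-Reasoning)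
open import Relation.Nullary using (¬_; yes; no; does; contradiction)
open import Relation.Nullary.Decidable using (map′; _⊎-dec_; _×-dec_)
open import Relation.Unary using (Pred; Decidable; _⊆_; _≐_; _∪_)
open import Relation.Unary.Properties using (_∪?_; ∅?; ≐-sym)
open import Function.Bundles using (Equivalence)

module _ {a b c : Level} {A : Set a} {B : Set b} {S : Set c} where

  foldl-concatMap : (f : S → B → S) (g : A → List B) (s : S) (xs : List A) →
                    foldl f s (concatMap g xs) ≡ foldl (λ s x → foldl f s (g x)) s xs
  foldl-concatMap f g s []       = refl
  foldl-concatMap f g s (x ∷ xs) = trans (foldl-++ f s (g x) _) (foldl-concatMap f g _ xs)

module _ {a c p q : Level} {A : Set a} {S : Set c} {Q : Pred A q} where

  foldl-invariant : (I : List A → S → Set p) {f : S → A → S} →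
                    (∀ {done s x} → Q x → I done s → I (x ∷ done) (f s x)) →
                    ∀ {done s} xs → All Q xs → I done s → I (reverseAcc done xs) (foldl f s xs)
  foldl-invariant I keep []       []         i = i
  foldl-invariant I keep (x ∷ xs) (qx ∷ qxs) i = foldl-invariant I keep xs qxs (keep qx i)

module _ {a : Level} {A : Set a} where

  take-take-≤ : ∀ {i j} (xs : List A) → i ≤ j → take i (take j xs) ≡ take i xs
  take-take-≤ {i} {j} xs i≤j = trans (take-take i j xs) (cong (λ m → take m xs) (m≤n⇒m⊓n≡m i≤j))

  take-precedes : ∀ {r} {R : Rel A r} j {xs x y} → AllPairs R xs →
                  x ∈ take j xs → y ∈ xs → y ∉ take j xs → R x y
  take-precedes (suc j) _          _           (here refl) y∉ = contradiction (here refl) y∉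
  take-precedes (suc j) (x≺ ∷ _)   (here refl) (there y∈)  _  = All.lookup x≺ y∈
  take-precedes (suc j) (_ ∷ xs↗) (there x∈)  (there y∈)  y∉ = take-precedes j xs↗ x∈ y∈ (y∉ ∘ there)

  module _ {p q : Level} {P : Pred A p} {Q : Pred A q} (P? : Decidable P) (Q? : Decidable Q) (Q⊆P : Q ⊆ P) where

    ∈-take-filter-antimono : ∀ j xs {x} → Q x → x ∈ take j (filter P? xs) → x ∈ take j (filter Q? xs)
    ∈-take-filter-antimono (suc j) (y ∷ ys) Qx x∈ with P? y | Q? y
    ... | yes _  | yes _  = case x∈ of λ where
      (here refl) → here refl
      (there x∈′) → there (∈-take-filter-antimono j ys Qx x∈′)
    ... | yes _  | no ¬Qy = case x∈ of λ where
      (here refl) → contradiction Qx ¬Qy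
      (there x∈′) → Any-resp-⊆ (take⁺ (n≤1+n j)) (∈-take-filter-antimono j ys Qx x∈′)
    ... | no ¬Py | yes Qy = contradiction (Q⊆P Qy) ¬Py
    ... | no _   | no _   = ∈-take-filter-antimono (suc j) ys Qx x∈

    take-filter-sandwich : ∀ j xs → (∀ {x} → x ∈ take j (filter P? xs) → Q x) →
                           take j (filter Q? xs) ≡ take j (filter P? xs)
    take-filter-sandwich zero    xs       _      = refl
    take-filter-sandwich (suc j) []       _      = refl
    take-filter-sandwich (suc j) (y ∷ ys) prefix with P? y | Q? y
    ... | yes _  | yes _  = cong (y ∷_) (take-filter-sandwich j ys (prefix ∘ there))
    ... | yes _  | no ¬Qy = contradiction (prefix (here refl)) ¬Qy
    ... | no ¬Py | yes Qy = contradiction (Q⊆P Qy) ¬Py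
    ... | no _   | no _   = take-filter-sandwich (suc j) ys prefix

module Walks {n : ℕ} (G : Graph n) where

  Within-suc : ∀ {d u w} → Within G d u w → Within G (suc d) u w
  Within-suc here       = here
  Within-suc (step p e) = step (Within-suc p) e

  stepˡ : ∀ {d u x w} → adj G u x ≡ true → Within G d x w → Within G (suc d) u w
  stepˡ e here       = step here e
  stepˡ e (step p f) = step (stepˡ e p) f

  stepˡ⁻ : ∀ {d u w} → Within G (suc d) u w → u ≡ w ⊎ ∃[ x ] adj G u x ≡ true × Within G d x w
  stepˡ⁻         here            = inj₁ refl
  stepˡ⁻ {zero}  (step here e)   = inj₂ (_ , e , here)
  stepˡ⁻ {suc d} (step p e) with stepˡ⁻ p
  ... | inj₁ refl          = inj₂ (_ , e , here)
  ... | inj₂ (x , e′ , q) = inj₂ (x , e′ , step q e)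

  within? : ∀ d u → Decidable (Within G d u)
  within? zero    u w = map′ (λ { refl → here }) (λ { here → refl }) (u ≟ w)
  within? (suc d) u w =
    map′ [ (λ { refl → here }) , (λ (x , p , e) → step p e) ]′ stepʳ⁻
         (u ≟ w ⊎-dec any? (λ x → within? d u x ×-dec adj G x w Bool.≟ true))
    where
    stepʳ⁻ : Within G (suc d) u w → u ≡ w ⊎ ∃[ x ] Within G d u x × adj G x w ≡ true
    stepʳ⁻ here       = inj₁ refl
    stepʳ⁻ (step p e) = inj₂ (_ , p , e)

  AtDistance : ℕ → Fin n → Fin n → Set
  AtDistance zero    u v = u ≡ v
  AtDistance (suc d) u v = Within G (suc d) u v × ¬ Within G d u v

  AtDistance⇒Within : ∀ d {u v} → AtDistance d u v → Within G d u v
  AtDistance⇒Within zero    refl    = here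
  AtDistance⇒Within (suc d) (p , _) = p

  AtDistance-suc⁻ : ∀ d {u v} → AtDistance (suc d) u v → ∃[ x ] adj G u x ≡ true × AtDistance d x v
  AtDistance-suc⁻ zero (p , u≁v) with stepˡ⁻ p
  ... | inj₁ refl             = contradiction here u≁v
  ... | inj₂ (x , e , here)   = x , e , refl
  AtDistance-suc⁻ (suc d) (p , u≁v) with stepˡ⁻ p
  ... | inj₁ refl             = contradiction here u≁v
  ... | inj₂ (x , e , q)      = x , e , q , u≁v ∘ stepˡ e

module Correctness {n : ℕ} (G : Graph n) (π : Permutation′ n) (k : ℕ) where
  open Algorithm G π k
  open Walks G
  open ≡-Reasoning
  open import Data.List.Membership.DecPropositional (_≟_ {n}) using (_∈?_)

  _≺_ : Rel (Fin n) 0ℓ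
  x ≺ y = rank π x < rank π y

  ≺⇒≢ : ∀ {x y} → x ≺ y → x ≢ y
  ≺⇒≢ x≺y refl = <-irrefl refl x≺y

  Sorted : List (Fin n) → Set
  Sorted = AllPairs _≺_

  byRank-sorted : Sorted (byRank π)
  byRank-sorted = AllPairs.map⁺ (AllPairs.tabulate⁺-< λ {i} {j} →
    subst₂ _<_ (cong toℕ (sym (inverseʳ π {i}))) (cong toℕ (sym (inverseʳ π {j}))))

  ∈-byRank : ∀ v → v ∈ byRank π
  ∈-byRank v = subst (_∈ byRank π) (inverseˡ π) (∈-map⁺ (π ⟨$⟩ˡ_) (∈-allFin (π ⟨$⟩ʳ v)))

  insertR-≡ : ∀ v xs → insertR v (v ∷ xs) ≡ v ∷ xs
  insertR-≡ v xs with v ≟ v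
  ... | yes _   = refl
  ... | no v≢v = contradiction refl v≢v

  insertR-≺ : ∀ {v x} xs → v ≺ x → insertR v (x ∷ xs) ≡ v ∷ x ∷ xs
  insertR-≺ {v} {x} xs v≺x with v ≟ x
  ... | yes refl = contradiction refl (≺⇒≢ v≺x)
  ... | no _ with rank π v <ᵇ rank π x | <⇒<ᵇ v≺x
  ...   | true | _ = refl

  insertR-≻ : ∀ {v x} xs → x ≺ v → insertR v (x ∷ xs) ≡ x ∷ insertR v xs
  insertR-≻ {v} {x} xs x≺v with v ≟ x
  ... | yes refl = contradiction refl (≺⇒≢ x≺v)
  ... | no _ with rank π v <ᵇ rank π x | <ᵇ⇒< (rank π v) (rank π x)
  ...   | true  | v≺x = contradiction (v≺x tt) (<-asym x≺v)
  ...   | false | _    = refl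

  insertR-minimal : ∀ {v} xs → All (v ≺_) xs → insertR v xs ≡ v ∷ xs
  insertR-minimal []       []          = refl
  insertR-minimal (x ∷ xs) (v≺x ∷ _) = insertR-≺ xs v≺x

  take-insertR-take : ∀ j v xs → take j (insertR v (take j xs)) ≡ take j (insertR v xs)
  take-insertR-take zero    v xs       = refl
  take-insertR-take (suc j) v []       = refl
  take-insertR-take (suc j) v (x ∷ xs) with does (v ≟ x)
  ... | true = cong (x ∷_) (take-take-≤ xs ≤-refl)
  ... | false with rank π v <ᵇ rank π x
  ...   | true  = cong (v ∷_) (take-cons-take j)
    where
    take-cons-take : ∀ i → take i (x ∷ take i xs) ≡ take i (x ∷ xs)
    take-cons-take zero    = refl
    take-cons-take (suc i) = cong (x ∷_) (take-take-≤ xs (n≤1+n i))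
  ...   | false = cong (x ∷_) (take-insertR-take j v xs)

  module _ {P : Pred (Fin n) 0ℓ} (P? : Decidable P) where

    filter-∪-absent : ∀ {v} xs → All (v ≺_) xs → filter (P? ∪? (_≟ v)) xs ≡ filter P? xs
    filter-∪-absent []       []             = refl
    filter-∪-absent {v} (y ∷ ys) (v≺y ∷ v≺ys) = case P? y of λ where
      (yes Py)  → begin
        filter (P? ∪? (_≟ v)) (y ∷ ys)  ≡⟨ filter-accept (P? ∪? (_≟ v)) (inj₁ Py) ⟩
        y ∷ filter (P? ∪? (_≟ v)) ys    ≡⟨ cong (y ∷_) (filter-∪-absent ys v≺ys) ⟩
        y ∷ filter P? ys                ≡⟨ filter-accept P? Py ⟨
        filter P? (y ∷ ys)              ∎
      (no ¬Py) → begin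
        filter (P? ∪? (_≟ v)) (y ∷ ys)  ≡⟨ filter-reject (P? ∪? (_≟ v)) [ ¬Py , ≺⇒≢ v≺y ∘ sym ]′ ⟩
        filter (P? ∪? (_≟ v)) ys        ≡⟨ filter-∪-absent ys v≺ys ⟩
        filter P? ys                    ≡⟨ filter-reject P? ¬Py ⟨
        filter P? (y ∷ ys)              ∎

    insertR-filter : ∀ {v xs} → Sorted xs → v ∈ xs → insertR v (filter P? xs) ≡ filter (P? ∪? (_≟ v)) xs
    insertR-filter {v} {v ∷ ys} (v≺ys ∷ _) (here refl) = begin
      insertR v (filter P? (v ∷ ys))   ≡⟨ insert-head ⟩
      v ∷ filter P? ys                 ≡⟨ cong (v ∷_) (filter-∪-absent ys v≺ys) ⟨
      v ∷ filter (P? ∪? (_≟ v)) ys     ≡⟨ filter-accept (P? ∪? (_≟ v)) (inj₂ refl) ⟨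
      filter (P? ∪? (_≟ v)) (v ∷ ys)   ∎
      where
      insert-head : insertR v (filter P? (v ∷ ys)) ≡ v ∷ filter P? ys
      insert-head with P? v
      ... | yes _ = insertR-≡ v (filter P? ys)
      ... | no _  = insertR-minimal (filter P? ys) (All.filter⁺ P? v≺ys)
    insertR-filter {v} {x ∷ ys} (x≺ys ∷ ys↗) (there v∈) = case P? x of λ where
      (yes Px)  → begin
        insertR v (filter P? (x ∷ ys))      ≡⟨ cong (insertR v) (filter-accept P? Px) ⟩
        insertR v (x ∷ filter P? ys)        ≡⟨ insertR-≻ (filter P? ys) (All.lookup x≺ys v∈) ⟩
        x ∷ insertR v (filter P? ys)        ≡⟨ cong (x ∷_) (insertR-filter ys↗ v∈) ⟩
        x ∷ filter (P? ∪? (_≟ v)) ys        ≡⟨ filter-accept (P? ∪? (_≟ v)) (inj₁ Px) ⟨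
        filter (P? ∪? (_≟ v)) (x ∷ ys)      ∎
      (no ¬Px) → begin
        insertR v (filter P? (x ∷ ys))      ≡⟨ cong (insertR v) (filter-reject P? ¬Px) ⟩
        insertR v (filter P? ys)            ≡⟨ insertR-filter ys↗ v∈ ⟩
        filter (P? ∪? (_≟ v)) ys            ≡⟨ filter-reject (P? ∪? (_≟ v)) [ ¬Px , ≺⇒≢ (All.lookup x≺ys v∈) ]′ ⟨
        filter (P? ∪? (_≟ v)) (x ∷ ys)      ∎

  lowest : {P : Pred (Fin n) 0ℓ} → Decidable P → List (Fin n)
  lowest P? = take k (filter P? (byRank π))

  module _ {P : Pred (Fin n) 0ℓ} (P? : Decidable P) where

    mergePurify-lowest : ∀ v → mergePurify (lowest P?) v ≡ lowest (P? ∪? (_≟ v))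
    mergePurify-lowest v = trans (take-insertR-take k v _)
                                 (cong (take k) (insertR-filter P? byRank-sorted (∈-byRank v)))

    lowest-cong : {Q : Pred (Fin n) 0ℓ} (Q? : Decidable Q) → P ≐ Q → lowest P? ≡ lowest Q?
    lowest-cong Q? P≐Q = cong (take k) (filter-≐ P? Q? P≐Q (byRank π))

    all-lowest : All P (lowest P?)
    all-lowest = All.take⁺ k (All.all-filter P? (byRank π))

    lowest-isBottom : IsBottom π k P (lowest P?)
    lowest-isBottom =
        AllPairs.map ≺⇒≢ (AllPairs.take⁺ k M-sorted)
      , all-lowest
      , subst (_≤ k) (sym (length-take k M)) (m⊓n≤m k (length M))
      , full-or-everything
      , λ x y x∈ Py y∉ → take-precedes k M-sorted x∈ (∈-filter⁺ P? (∈-byRank y) Py) y∉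
      where
      M = filter P? (byRank π)
      M-sorted : Sorted M
      M-sorted = AllPairs.filter⁺ P? byRank-sorted
      full-or-everything : length (lowest P?) ≡ k ⊎ (∀ y → P y → y ∈ lowest P?)
      full-or-everything with k ≤? length M
      ... | yes k≤ = inj₁ (trans (length-take k M) (m≤n⇒m⊓n≡m k≤))
      ... | no k≰  = inj₂ λ y Py → subst (y ∈_) (sym (take-all k M (≰⇒≥ k≰))) (∈-filter⁺ P? (∈-byRank y) Py)

  module ProcessTarget (t : State) (v w : Fin n) where

    Added : Set
    Added = v ∈ mergePurify (X t w) v × v ∉ X t w

    ∈-A⁺ : ∀ {u x} → u ∈ A t x → u ∈ A (processTarget v t w) x
    ∈-A⁺ {u} {x} u∈ with v ∈? mergePurify (X t w) v | v ∈? X t w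
    ... | yes _ | no _ with x ≟ v
    ...   | yes refl = there u∈
    ...   | no _     = u∈
    ∈-A⁺ u∈ | yes _ | yes _ = u∈
    ∈-A⁺ u∈ | no _  | _     = u∈

    ∈-A⁻ : ∀ {u x} → u ∈ A (processTarget v t w) x → u ∈ A t x ⊎ (x ≡ v × u ≡ w × Added)
    ∈-A⁻ {u} {x} u∈ with v ∈? mergePurify (X t w) v | v ∈? X t w
    ... | yes v∈new | no v∉X with x ≟ v
    ...   | yes refl = case u∈ of λ where
      (here refl) → inj₂ (refl , refl , v∈new , v∉X)
      (there u∈′) → inj₁ u∈′
    ...   | no _     = inj₁ u∈
    ∈-A⁻ u∈ | yes _ | yes _ = inj₁ u∈
    ∈-A⁻ u∈ | no _  | _     = inj₁ u∈

    added⇒∈-A : Added → w ∈ A (processTarget v t w) v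
    added⇒∈-A (v∈new , v∉X) with v ∈? mergePurify (X t w) v | v ∈? X t w
    ... | yes _ | no _ with v ≟ v
    ...   | yes _   = here refl
    ...   | no v≢v = contradiction refl v≢v
    added⇒∈-A (v∈new , v∉X) | yes _    | yes v∈X = contradiction v∈X v∉X
    added⇒∈-A (v∈new , v∉X) | no v∉new | _       = contradiction v∈new v∉new

    changed⁺ : T (changed t) ⊎ Added → T (changed (processTarget v t w))
    changed⁺ (inj₁ ch) = Equivalence.from T-∨ (inj₁ ch)
    changed⁺ (inj₂ (v∈new , v∉X)) with ≡-dec _≟_ (X t w) (mergePurify (X t w) v)
    ... | yes X≡new = contradiction (subst (v ∈_) (sym X≡new) v∈new) v∉X
    ... | no _      = Equivalence.from T-∨ (inj₂ tt)

  Enters : ℕ → Fin n → Fin n → Set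
  Enters d u v = AtDistance d u v × v ∈ lowest (within? d u)

  record Invariant (d : ℕ) (s : State) : Set where
    field
      sketch   : ∀ w → X s w ≡ lowest (within? d w)
      A-within : ∀ {u v} → u ∈ A s v → Within G d u v
      A-enters : ∀ {u v} → Enters d u v → u ∈ A s v

  initial-invariant : 1 ≤ k → Invariant 0 initial
  initial-invariant 1≤k = record
    { sketch   = singleton-sketch
    ; A-within = λ { (here refl) → here }
    ; A-enters = λ { (refl , _) → here refl } }
    where
    singleton-sketch : ∀ w → w ∷ [] ≡ lowest (within? 0 w)
    singleton-sketch w = begin
      w ∷ []                        ≡⟨ take-singleton 1≤k ⟨
      mergePurify [] w              ≡⟨ cong (λ L → mergePurify L w) lowest-∅ ⟨
      mergePurify (lowest ∅?) w     ≡⟨ mergePurify-lowest ∅? w ⟩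
      lowest (∅? ∪? (_≟ w))          ≡⟨ lowest-cong (∅? ∪? (_≟ w)) (within? 0 w) ((λ { (inj₂ refl) → here })
                                                                          , (λ { here → inj₂ refl })) ⟩
      lowest (within? 0 w)          ∎
      where
      take-singleton : ∀ {j} → 1 ≤ j → take j (w ∷ []) ≡ w ∷ []
      take-singleton {suc j} _ = cong (w ∷_) (take-[] j)
      lowest-∅ : lowest ∅? ≡ []
      lowest-∅ = trans (cong (take k) (filter-none ∅? {byRank π} (All.universal (λ _ ()) _))) (take-[] k)

  module Round {d : ℕ} {s : State} (inv : Invariant d s) where
    private module I = Invariant inv
    open import Data.List.Membership.DecPropositional (×-≡-dec (_≟_ {n}) (_≟_ {n})) using () renaming (_∈?_ to _∈ᵖ?_)

    Target : Fin n → Fin n → Set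
    Target v w = T (inN (A s v) w)

    Target⁻ : ∀ {v w} → Target v w → ∃[ x ] x ∈ A s v × (x ≡ w ⊎ adj G x w ≡ true)
    Target⁻ {v} {w} t with find (any⁻ _ (A s v) t)
    ... | x , x∈ , px with x ≟ w
    ...   | yes x≡w = x , x∈ , inj₁ x≡w
    ...   | no _    = x , x∈ , inj₂ (Equivalence.to T-≡ px)

    target⇒within : ∀ {v w} → Target v w → Within G (suc d) w v
    target⇒within t with Target⁻ t
    ... | x , x∈ , inj₁ refl = Within-suc (I.A-within x∈)
    ... | x , x∈ , inj₂ x~w  = stepˡ (trans (symm G _ x) x~w) (I.A-within x∈)

    enters⇒target : ∀ {u v} → Enters (suc d) u v → Target v u
    enters⇒target {u} {v} (at , v∈) with AtDistance-suc⁻ d at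
    ... | x , u~x , x-at = any⁺ _ (Any.map (λ { refl → x-neighbour }) (I.A-enters (x-at , v∈near)))
      where
      v∈near : v ∈ lowest (within? d x)
      v∈near = ∈-take-filter-antimono (within? (suc d) u) (within? d x) (stepˡ u~x) k (byRank π)
                                  (AtDistance⇒Within d x-at) v∈
      x-neighbour : T (does (x ≟ u) Bool.∨ adj G x u)
      x-neighbour = Equivalence.from T-∨ (inj₂ (Equivalence.from T-≡ (trans (symm G x u) u~x)))

    lowest-between : ∀ w {Q : Pred (Fin n) 0ℓ} (Q? : Decidable Q) → Within G d w ⊆ Q → Q ⊆ Within G (suc d) w →
                     (∀ {m} → Target m w → Q m) → lowest Q? ≡ lowest (within? (suc d) w)
    lowest-between w {Q} Q? near⊆Q Q⊆ targets⊆Q =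
      take-filter-sandwich (within? (suc d) w) Q? Q⊆ k (byRank π) reached
      where
      reached : ∀ {m} → m ∈ lowest (within? (suc d) w) → Q m
      reached {m} m∈ with within? d w m
      ... | yes near = near⊆Q near
      ... | no far   = targets⊆Q (enters⇒target ((All.lookup (all-lowest _) m∈ , far) , m∈))

    settled-invariant : (∀ {u v} → u ∉ A s v) → Invariant (suc d) s
    settled-invariant none = record
      { sketch   = λ w → trans (I.sketch w)
                                (lowest-between w (within? d w) (λ near → near) Within-suc (⊥-elim ∘ no-target))
      ; A-within = ⊥-elim ∘ none
      ; A-enters = ⊥-elim ∘ no-target ∘ enters⇒target }
      where
      no-target : ∀ {v w} → ¬ Target v w
      no-target t = none (proj₁ (proj₂ (Target⁻ t)))

    targets : Fin n → List (Fin n)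
    targets v = filterᵇ (inN (A s v)) (allFin n)

    targetPairs : List (Fin n × Fin n)
    targetPairs = concatMap (λ v → map (v ,_) (targets v)) (byRank π)

    processPair : State → Fin n × Fin n → State
    processPair t (v , w) = processTarget v t w

    iteration-pairs : iteration s ≡ foldl processPair (st (X s) (λ _ → []) false) targetPairs
    iteration-pairs = begin
      foldl (processVertex (A s)) s₀ (byRank π)
        ≡⟨ foldl-cong (λ t v → sym (foldl-map processPair (v ,_) t (targets v))) s₀ (byRank π) ⟩
      foldl (λ t v → foldl processPair t (map (v ,_) (targets v))) s₀ (byRank π)
        ≡⟨ foldl-concatMap processPair _ s₀ (byRank π) ⟨
      foldl processPair s₀ targetPairs
        ∎
      where s₀ = st (X s) (λ _ → []) false

    ∈-targetPairs : ∀ {v w} → Target v w → (v , w) ∈ targetPairs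
    ∈-targetPairs {v} {w} t =
      ∈-concatMap⁺ _ (Any.map (λ { refl → ∈-map⁺ (v ,_) (∈-filter⁺ (T? ∘ inN (A s v)) (∈-allFin w) t) })
                              (∈-byRank v))

    targetPairs-targets : All (uncurry Target) targetPairs
    targetPairs-targets = All.concat⁺ (All.map⁺ (All.universal
      (λ v → All.map⁺ (All.all-filter (T? ∘ inN (A s v)) (allFin n))) (byRank π)))

    Seen : List (Fin n × Fin n) → Fin n → Pred (Fin n) 0ℓ
    Seen done w m = Within G d w m ⊎ (m , w) ∈ done

    seen? : ∀ done w → Decidable (Seen done w)
    seen? done w m = within? d w m ⊎-dec (m , w) ∈ᵖ? done

    Seen-∷ : ∀ {done v w} → Seen ((v , w) ∷ done) w ≐ (Seen done w ∪ (_≡ v))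
    Seen-∷ = (λ where
                (inj₁ near)        → inj₁ (inj₁ near)
                (inj₂ (here refl)) → inj₂ refl
                (inj₂ (there p))   → inj₁ (inj₂ p))
           , (λ where
                (inj₁ (inj₁ near)) → inj₁ near
                (inj₁ (inj₂ p))    → inj₂ (there p)
                (inj₂ refl)        → inj₂ (here refl))

    Seen-∷-other : ∀ {done v w u} → u ≢ w → Seen ((v , w) ∷ done) u ≐ Seen done u
    Seen-∷-other u≢w = (λ where
                          (inj₁ near)        → inj₁ near
                          (inj₂ (here refl)) → contradiction refl u≢w
                          (inj₂ (there p))   → inj₂ p)
                     , Sum.map₂ there

    record Progress (done : List (Fin n × Fin n)) (t : State) : Set where
      field
        sketch      : ∀ w → X t w ≡ lowest (seen? done w)
        done-within : ∀ {m w} → (m , w) ∈ done → Within G (suc d) w m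
        A-within    : ∀ {u v} → u ∈ A t v → Within G (suc d) u v
        A-enters    : ∀ {u v} → (v , u) ∈ done → Enters (suc d) u v → u ∈ A t v
        A-changed   : ∀ {u v} → u ∈ A t v → T (changed t)

    progress-start : Progress [] (st (X s) (λ _ → []) false)
    progress-start = record
      { sketch      = λ w → trans (I.sketch w) (lowest-cong (within? d w) (seen? [] w) (inj₁ , λ { (inj₁ near) → near }))
      ; done-within = λ ()
      ; A-within    = λ ()
      ; A-enters    = λ ()
      ; A-changed   = λ () }

    progress-step : ∀ {done t v w} → Target v w → Progress done t → Progress ((v , w) ∷ done) (processTarget v t w)
    progress-step {done} {t} {v} {w} target pr = record
      { sketch      = sketch′
      ; done-within = λ { (here refl) → target⇒within target ; (there p) → P.done-within p }
      ; A-within    = λ u∈ → case ∈-A⁻ u∈ of λ where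
                        (inj₁ u∈′)               → P.A-within u∈′
                        (inj₂ (refl , refl , _)) → target⇒within target
      ; A-enters    = enters′
      ; A-changed   = λ u∈ → changed⁺ (Sum.map P.A-changed (proj₂ ∘ proj₂) (∈-A⁻ u∈)) }
      where
      module P = Progress pr
      open ProcessTarget t v w
      new≡ : mergePurify (X t w) v ≡ lowest (seen? done w ∪? (_≟ v))
      new≡ = trans (cong (λ L → mergePurify L v) (P.sketch w)) (mergePurify-lowest (seen? done w) v)
      ∈-new : v ∈ lowest (within? (suc d) w) → v ∈ mergePurify (X t w) v
      ∈-new v∈ = subst (v ∈_) (sym new≡) (∈-take-filter-antimono (within? (suc d) w) (seen? done w ∪? (_≟ v))
        [ [ Within-suc , P.done-within ]′ , (λ { refl → target⇒within target }) ]′ k (byRank π) (inj₂ refl) v∈)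
      sketch′ : ∀ u → X (processTarget v t w) u ≡ lowest (seen? ((v , w) ∷ done) u)
      sketch′ u with u ≟ w
      ... | yes refl = trans new≡ (lowest-cong _ _ (≐-sym Seen-∷))
      ... | no u≢w  = trans (P.sketch u) (lowest-cong _ _ (≐-sym (Seen-∷-other u≢w)))
      enters′ : ∀ {u x} → (x , u) ∈ (v , w) ∷ done → Enters (suc d) u x → u ∈ A (processTarget v t w) x
      enters′ (there p)   e = ∈-A⁺ (P.A-enters p e)
      enters′ (here refl) e@((_ , far) , v∈) = case v ∈? X t w of λ where
        (no v∉X)  → added⇒∈-A (∈-new v∈ , v∉X)
        (yes v∈X) → case All.lookup (all-lowest _) (subst (v ∈_) (P.sketch w) v∈X) of λ where
          (inj₁ near) → contradiction near far
          (inj₂ p)    → ∈-A⁺ (P.A-enters p e)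

    iteration-progress : Progress (reverse targetPairs) (iteration s)
    iteration-progress = subst (Progress (reverse targetPairs)) (sym iteration-pairs)
      (foldl-invariant Progress {processPair} progress-step targetPairs targetPairs-targets progress-start)

    iteration-invariant : Invariant (suc d) (iteration s)
    iteration-invariant = record
      { sketch   = λ w → trans (P.sketch w) (lowest-between w (seen? E w) inj₁ [ Within-suc , P.done-within ]′
                                                        (inj₂ ∘ reverse⁺ ∘ ∈-targetPairs))
      ; A-within = P.A-within
      ; A-enters = λ e → P.A-enters (reverse⁺ (∈-targetPairs (enters⇒target e))) e }
      where
      module P = Progress iteration-progress
      E = reverse targetPairs

    iteration-settled : changed (iteration s) ≡ false → ∀ {u v} → u ∉ A (iteration s) v
    iteration-settled unchanged u∈ = subst T unchanged (Progress.A-changed iteration-progress u∈)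

  open Round using (settled-invariant; iteration-invariant; iteration-settled)

  settled-iterate : ∀ m {d s} → Invariant d s → (∀ {u v} → u ∉ A s v) → Invariant (m + d) s
  settled-iterate zero    inv none = inv
  settled-iterate (suc m) inv none = settled-invariant (settled-iterate m inv none) none

  run-lowest : ∀ m {d} s → Invariant d s → ∀ w → run m s w ≡ lowest (within? (m + d) w)
  run-lowest zero        s inv   = Invariant.sketch inv
  run-lowest (suc m) {d} s inv w with changed (iteration s) in unchanged
  ... | true  = trans (run-lowest m (iteration s) (iteration-invariant inv) w)
                      (cong (λ e → lowest (within? e w)) (+-suc m d))
  ... | false = trans (Invariant.sketch (settled-iterate m (iteration-invariant inv) (iteration-settled inv unchanged)) w)
                      (cong (λ e → lowest (within? e w)) (+-suc m d))

corollary2 : ∀ {n} (G : Graph n) (π : Permutation′ n) (k ℓ : ℕ) → 1 ≤ k → 1 ≤ ℓ →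
    (v : Fin n) → IsBottom π k ((N[ G ] ℓ) v) (buildSketches G π k ℓ v)
corollary2 G π k ℓ 1≤k _ v = subst (IsBottom π k (Within G ℓ v)) (sym sketch≡) (lowest-isBottom (within? ℓ v))
  where
  open Walks G
  open Correctness G π k
  sketch≡ : buildSketches G π k ℓ v ≡ lowest (within? ℓ v)
  sketch≡ = trans (run-lowest ℓ (Algorithm.initial G π k) (initial-invariant 1≤k) v)
                  (cong (λ e → lowest (within? e v)) (+-identityʳ ℓ))
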